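{- Let $n\ge 2$ be an integer, let $A\subseteq \mathbb{Z}_n\setminus\{0\}$ be a subset which is a subgroup of $U(n)$, let $p$ be a prime divisor of $n$, let $n'=n/p$ and let $A'=U(n')$ in the first statement below. Precisely: let $A=U(n)$ where $n$ is odd, let $p$ be a prime divisor of $n$, $n'=n/p$ and $A'=U(n')$. Suppose $S_1':(u_1,\ldots,u_k)$ and $S_2':(v_1,\ldots,v_k)$ are $A'$-extremal sequences in $\mathbb{Z}_{n'}$, and let $x^*\in\mathbb{Z}_n$ be an element not divisible by $p$. Define the sequence $S:(p\,u_1,\ldots,p\,u_k,\,x^*,\,p\,v_1,\ldots,p\,v_k)$ in $\mathbb{Z}_n$. Then $S$ is an $A$-extremal sequence in $\mathbb{Z}_n$.
   Context: For an integer $m\ge 1$, $\mathbb{Z}_m=\mathbb{Z}/m\mathbb{Z}$ and $U(m)$ is its group of units. For $B\subseteq\mathbb{Z}_m\setminus\{0\}$, a sequence $(x_1,\ldots,x_k)$ ($k\ge1$) in $\mathbb{Z}_m$ is a $B$-weighted zero-sum sequence if there exist $b_1,\ldots,b_k\in B$ with $b_1x_1+\cdots+b_kx_k=0$. A subsequence of consecutive terms of $(x_1,\ldots,x_k)$ is a nonempty block $(x_i,x_{i+1},\ldots,x_j)$ with $1\le i\le j\le k$. $C_B(m)$ is the least positive integer $k$ such that every sequence of length $k$ in $\mathbb{Z}_m$ has a $B$-weighted zero-sum subsequence of consecutive terms. A sequence in $\mathbb{Z}_m$ is $B$-extremal if it has length $C_B(m)-1$ and has no $B$-weighted zero-sum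 subsequence of consecutive terms. For $u\in\mathbb{Z}_{n'}$ with $n'=n/p$, $p\,u$ denotes the element of $\mathbb{Z}_n$ obtained by multiplying any integer representative of $u$ by $p$ (well defined modulo $n$). An element of $\mathbb{Z}_n$ is divisible by $p$ (for $p\mid n$) if its integer representatives are multiples of $p$. -}

module Defs where

open import Data.Nat using (ℕ; zero; suc; _+_; _*_; _<_; _≤_; NonZero)
open import Data.Nat.Properties using (*-monoˡ-<)
open import Data.Nat.Divisibility using (_∣_)
open import Data.Nat.Coprimality using (Coprime)
open import Data.Fin using (Fin; toℕ; fromℕ<)
open import Data.Fin.Properties using (toℕ<n)
open import Data.List using (List; []; _∷_; _++_; length; zipWith; map)
open import Data.Nat.ListAction using (sum)
open import Data.List.Relation.Unary.All using (All)
open import Data.Product using (Σ; _×_; ∃; ∃-syntax)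
open import Relation.Nullary using (¬_)
open import Relation.Binary.PropositionalEquality using (_≡_; subst; sym)

-- Elements of ℤ_m are represented by Fin m (canonical representatives 0..m-1).
-- A weight set B ⊆ ℤ_m is a predicate on Fin m.

U : (m : ℕ) → Fin m → Set
U m x = Coprime (toℕ x) m

WeightedZeroSum : (m : ℕ) → (Fin m → Set) → List (Fin m) → Set
WeightedZeroSum m B xs =
  (1 ≤ length xs) ×
  Σ (List (Fin m)) λ bs →
    (length bs ≡ length xs) × All B bs ×
    (m ∣ sum (zipWith (λ b x → toℕ b * toℕ x) bs xs))

-- xs has a B-weighted zero-sum subsequence of consecutive terms
-- (a nonempty block; nonemptiness is part of WeightedZeroSum).
HasZSBlock : (m : ℕ) → (Fin m → Set) → List (Fin m) → Set
HasZSBlock m B xs =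
  ∃[ pre ] ∃[ blk ] ∃[ post ] (xs ≡ pre ++ blk ++ post) × WeightedZeroSum m B blk

AllHaveZSBlock : (m : ℕ) → (Fin m → Set) → ℕ → Set
AllHaveZSBlock m B k = ∀ (xs : List (Fin m)) → length xs ≡ k → HasZSBlock m B xs

IsC : (m : ℕ) → (Fin m → Set) → ℕ → Set
IsC m B c = (1 ≤ c) × AllHaveZSBlock m B c × (∀ k → 1 ≤ k → AllHaveZSBlock m B k → c ≤ k)

Extremal : (m : ℕ) → (Fin m → Set) → List (Fin m) → Set
Extremal m B xs =
  (∃[ c ] IsC m B c × (suc (length xs) ≡ c)) × ¬ HasZSBlock m B xs

scale : ∀ {n n'} (p : ℕ) .{{_ : NonZero p}} → n ≡ n' * p → Fin n' → Fin n
scale {n} {n'} p eq u =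
  fromℕ< (subst (λ t → toℕ u * p < t) (sym eq) (*-monoˡ-< p (toℕ<n u)))

-- A block through x* has weighted sum prime to p: every other term is a multiple of p and the
-- weight of x* is a unit. A block inside p·S′ᵢ gives, after cancelling p and reducing its weights
-- mod n′, a block of S′ᵢ. So S has no zero-sum block, whence C_A(n) > |S| = 2 C_{A′}(n′) − 1.
-- Conversely, a sequence of length 2c, c = C_{A′}(n′), contains c consecutive blocks with
-- A-weighted sum divisible by p: a single multiple of p, or two terms prime to p enclosing
-- multiples of p, the first one weighted by a unit solving a congruence mod p. If the block sums
-- are p·qⱼ, the sequence (qⱼ mod n′) has an A′-weighted zero-sum block; lifting its weights to
-- units of ℤ_n and multiplying them into the corresponding blocks yields an A-weighted zero-sum
-- block of the original sequence.

module Submission where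

open import Defs
open import Function using (_∘_)
open import Data.Nat
open import Data.Nat.Properties
open import Data.Nat.DivMod
open import Data.Nat.Divisibility
open import Data.Nat.Coprimality as Coprime using (Coprime; 1-coprimeTo; coprime-divisor; coprime-Bézout)
open import Data.Nat.GCD using (module Bézout)
open import Data.Nat.Primality using (Prime; prime⇒irreducible; prime⇒nonTrivial; prime⇒nonZero; euclidsLemma)
open import Data.Nat.Induction using (<-rec)
open import Data.Nat.ListAction using (sum)
open import Data.Nat.Tactic.RingSolver using (solve-∀)
open import Data.Fin using (Fin; toℕ; fromℕ<)
open import Data.Fin.Properties using (toℕ-fromℕ<)
open import Data.List hiding (sum; [_])
open import Data.List.Properties
open import Data.List.Relation.Unary.All as All using (All; []; _∷_)
import Data.List.Relation.Unary.All.Properties as All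
open import Data.Product using (∃; ∃-syntax; Σ; _×_; _,_; proj₁; proj₂)
open import Data.Sum using (_⊎_; inj₁; inj₂; [_,_])
open import Relation.Nullary using (¬_; yes; no; contradiction)
open import Relation.Unary using (Decidable)
open import Relation.Binary.PropositionalEquality hiding ([_])

private variable
  A B : Set

map-≡-++ : (f : A → B) (xs : List A) (ys zs : List B) → map f xs ≡ ys ++ zs →
  ∃[ ys′ ] ∃[ zs′ ] xs ≡ ys′ ++ zs′ × ys ≡ map f ys′ × zs ≡ map f zs′
map-≡-++ f xs       []       zs eq = [] , xs , refl , refl , sym eq
map-≡-++ f (x ∷ xs) (y ∷ ys) zs eq with ∷-injective eq
... | refl , eq′ with map-≡-++ f xs ys zs eq′
...   | ys′ , zs′ , refl , refl , refl = x ∷ ys′ , zs′ , refl , refl , refl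

map-≡-infix : (f : A → B) (xs : List A) (pre blk post : List B) →
  map f xs ≡ pre ++ blk ++ post →
  ∃[ pre′ ] ∃[ blk′ ] ∃[ post′ ] xs ≡ pre′ ++ blk′ ++ post′ × blk ≡ map f blk′
map-≡-infix f xs pre blk post eq with map-≡-++ f xs pre (blk ++ post) eq
... | pre′ , rest , refl , refl , eq′ with map-≡-++ f rest blk post (sym eq′)
...   | blk′ , post′ , refl , refl , refl = pre′ , blk′ , post′ , refl , refl

infix-++-assoc : (pre xs ys zs post : List A) →
  pre ++ (xs ++ ys ++ zs) ++ post ≡ (pre ++ xs) ++ ys ++ (zs ++ post)
infix-++-assoc pre xs ys zs post = begin
  pre ++ (xs ++ ys ++ zs) ++ post   ≡⟨ cong (pre ++_) (++-assoc xs (ys ++ zs) post) ⟩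
  pre ++ xs ++ (ys ++ zs) ++ post   ≡⟨ cong (λ t → pre ++ xs ++ t) (++-assoc ys zs post) ⟩
  pre ++ xs ++ ys ++ zs ++ post     ≡⟨ ++-assoc pre xs _ ⟨
  (pre ++ xs) ++ ys ++ zs ++ post   ∎
  where open ≡-Reasoning

length-map-++-∷ : (f : A → B) (xs : List A) (y : B) (zs : List A) →
  length (map f xs ++ y ∷ map f zs) ≡ length xs + suc (length zs)
length-map-++-∷ f xs y zs =
  trans (length-++ (map f xs)) (cong₂ (λ a b → a + suc b) (length-map f xs) (length-map f zs))

data InfixAround (as : List A) (x : A) (bs blk : List A) : Set where
  inLeft  : ∀ pre post → as ≡ pre ++ blk ++ post → InfixAround as x bs blk
  inRight : ∀ pre post → bs ≡ pre ++ blk ++ post → InfixAround as x bs blk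
  through : ∀ pre blk₁ blk₂ post → as ≡ pre ++ blk₁ → bs ≡ blk₂ ++ post →
            blk ≡ blk₁ ++ x ∷ blk₂ → InfixAround as x bs blk

private
  prefixAround : (as : List A) (x : A) (bs blk post : List A) → as ++ x ∷ bs ≡ blk ++ post →
    (∃[ post′ ] as ≡ blk ++ post′) ⊎
    (∃[ blk₁ ] ∃[ blk₂ ] as ≡ blk₁ × bs ≡ blk₂ ++ post × blk ≡ blk₁ ++ x ∷ blk₂)
  prefixAround as       x bs []        post eq = inj₁ (as , refl)
  prefixAround []       x bs (b ∷ blk) post eq with ∷-injective eq
  ... | refl , refl = inj₂ ([] , blk , refl , refl , refl)
  prefixAround (a ∷ as) x bs (b ∷ blk) post eq with ∷-injective eq
  ... | refl , eq′ with prefixAround as x bs blk post eq′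
  ...   | inj₁ (post′ , refl)                   = inj₁ (post′ , refl)
  ...   | inj₂ (blk₁ , blk₂ , refl , refl , refl) = inj₂ (a ∷ blk₁ , blk₂ , refl , refl , refl)

infixAround : (as : List A) (x : A) (bs pre blk post : List A) →
  as ++ x ∷ bs ≡ pre ++ blk ++ post → InfixAround as x bs blk
infixAround as x bs [] blk post eq with prefixAround as x bs blk post eq
... | inj₁ (post′ , eq′)                   = inLeft [] post′ eq′
... | inj₂ (blk₁ , blk₂ , refl , refl , eq′) = through [] blk₁ blk₂ post refl refl eq′
infixAround []       x bs (_ ∷ pre) blk post eq = inRight pre post (∷-injectiveʳ eq)
infixAround (a ∷ as) x bs (_ ∷ pre) blk post eq with ∷-injective eq
... | refl , eq′ with infixAround as x bs pre blk post eq′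
...   | inLeft pre′ post′ refl                      = inLeft (a ∷ pre′) post′ refl
...   | inRight pre′ post′ eq″                      = inRight pre′ post′ eq″
...   | through pre′ blk₁ blk₂ post′ refl eq″ eq‴ = through (a ∷ pre′) blk₁ blk₂ post′ refl eq″ eq‴

module _ (d : ℕ) .{{_ : NonZero d}} where

  +-cong-% : ∀ {a a′ b b′} → a % d ≡ a′ % d → b % d ≡ b′ % d → (a + b) % d ≡ (a′ + b′) % d
  +-cong-% {a} {a′} {b} {b′} ea eb = begin
    (a + b) % d              ≡⟨ %-distribˡ-+ a b d ⟩
    (a % d + b % d) % d      ≡⟨ cong₂ (λ u v → (u + v) % d) ea eb ⟩
    (a′ % d + b′ % d) % d    ≡⟨ %-distribˡ-+ a′ b′ d ⟨
    (a′ + b′) % d            ∎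
    where open ≡-Reasoning

  *-cong-% : ∀ {a a′ b b′} → a % d ≡ a′ % d → b % d ≡ b′ % d → (a * b) % d ≡ (a′ * b′) % d
  *-cong-% {a} {a′} {b} {b′} ea eb = begin
    (a * b) % d              ≡⟨ %-distribˡ-* a b d ⟩
    (a % d * (b % d)) % d    ≡⟨ cong₂ (λ u v → (u * v) % d) ea eb ⟩
    (a′ % d * (b′ % d)) % d  ≡⟨ %-distribˡ-* a′ b′ d ⟨
    (a′ * b′) % d            ∎
    where open ≡-Reasoning

  ∣-resp-% : ∀ {a b} → a % d ≡ b % d → d ∣ a → d ∣ b
  ∣-resp-% {a} {b} eq d∣a = m%n≡0⇒n∣m b d (trans (sym eq) (n∣m⇒m%n≡0 a d d∣a))

toℕ-mod : ∀ m d .{{_ : NonZero d}} → toℕ (m mod d) ≡ m % d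
toℕ-mod m d = toℕ-fromℕ< (m%n<n m d)

toℕ-mod-% : ∀ m d .{{_ : NonZero d}} → toℕ (m mod d) % d ≡ m % d
toℕ-mod-% m d = trans (cong (_% d) (toℕ-mod m d)) (m%n%n≡m%n m d)

weightedSum : (A → ℕ) → (B → ℕ) → List A → List B → ℕ
weightedSum f g as bs = sum (zipWith (λ a b → f a * g b) as bs)

module _ (f : A → ℕ) (g : B → ℕ) where

  weightedSum-++ : ∀ as₁ bs₁ {as₂ bs₂} → length as₁ ≡ length bs₁ →
    weightedSum f g (as₁ ++ as₂) (bs₁ ++ bs₂) ≡ weightedSum f g as₁ bs₁ + weightedSum f g as₂ bs₂
  weightedSum-++ []        []        _  = refl
  weightedSum-++ (a ∷ as₁) (b ∷ bs₁) eq =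
    trans (cong (f a * g b +_) (weightedSum-++ as₁ bs₁ (suc-injective eq)))
          (sym (+-assoc (f a * g b) _ _))

  weightedSum-*ˡ : ∀ c as bs → weightedSum (λ a → c * f a) g as bs ≡ c * weightedSum f g as bs
  weightedSum-*ˡ c []       bs       = sym (*-zeroʳ c)
  weightedSum-*ˡ c (a ∷ as) []       = sym (*-zeroʳ c)
  weightedSum-*ˡ c (a ∷ as) (b ∷ bs) =
    trans (cong₂ _+_ (*-assoc c (f a) (g b)) (weightedSum-*ˡ c as bs))
          (sym (*-distribˡ-+ c (f a * g b) _))

  weightedSum-*ʳ : ∀ c as bs → weightedSum f (λ b → g b * c) as bs ≡ weightedSum f g as bs * c
  weightedSum-*ʳ c []       bs       = refl
  weightedSum-*ʳ c (a ∷ as) []       = refl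
  weightedSum-*ʳ c (a ∷ as) (b ∷ bs) =
    trans (cong₂ _+_ (sym (*-assoc (f a) (g b) c)) (weightedSum-*ʳ c as bs))
          (sym (*-distribʳ-+ c (f a * g b) _))

  weightedSum-∣ : ∀ {d} as {bs} → All (λ b → d ∣ g b) bs → d ∣ weightedSum f g as bs
  weightedSum-∣ []       _            = _ ∣0
  weightedSum-∣ (a ∷ as) []           = _ ∣0
  weightedSum-∣ (a ∷ as) (d∣b ∷ d∣bs) = ∣m∣n⇒∣m+n (∣n⇒∣m*n (f a) d∣b) (weightedSum-∣ as d∣bs)

  weightedSum-mapˡ : ∀ {C : Set} (h : C → A) cs bs → weightedSum f g (map h cs) bs ≡ weightedSum (f ∘ h) g cs bs
  weightedSum-mapˡ h []       bs       = refl
  weightedSum-mapˡ h (c ∷ cs) []       = refl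
  weightedSum-mapˡ h (c ∷ cs) (b ∷ bs) = cong (f (h c) * g b +_) (weightedSum-mapˡ h cs bs)

  weightedSum-mapʳ : ∀ {C : Set} (h : C → B) as cs → weightedSum f g as (map h cs) ≡ weightedSum f (g ∘ h) as cs
  weightedSum-mapʳ h []       cs       = refl
  weightedSum-mapʳ h (a ∷ as) []       = refl
  weightedSum-mapʳ h (a ∷ as) (c ∷ cs) = cong (f a * g (h c) +_) (weightedSum-mapʳ h as cs)

module _ {f f′ : A → ℕ} {g g′ : B → ℕ} where

  weightedSum-cong : (∀ a → f a ≡ f′ a) → (∀ b → g b ≡ g′ b) → ∀ as bs →
    weightedSum f g as bs ≡ weightedSum f′ g′ as bs
  weightedSum-cong f≗ g≗ []       bs       = refl
  weightedSum-cong f≗ g≗ (a ∷ as) []       = refl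
  weightedSum-cong f≗ g≗ (a ∷ as) (b ∷ bs) = cong₂ _+_ (cong₂ _*_ (f≗ a) (g≗ b)) (weightedSum-cong f≗ g≗ as bs)

  weightedSum-cong-% : ∀ d .{{_ : NonZero d}} → (∀ a → f a % d ≡ f′ a % d) → (∀ b → g b % d ≡ g′ b % d) →
    ∀ as bs → weightedSum f g as bs % d ≡ weightedSum f′ g′ as bs % d
  weightedSum-cong-% d f≈ g≈ []       bs       = refl
  weightedSum-cong-% d f≈ g≈ (a ∷ as) []       = refl
  weightedSum-cong-% d f≈ g≈ (a ∷ as) (b ∷ bs) =
    +-cong-% d (*-cong-% d (f≈ a) (g≈ b)) (weightedSum-cong-% d f≈ g≈ as bs)

weightedSum-pivot-¬∣ : ∀ {A B : Set} {f : A → ℕ} {g : B → ℕ} {p} → Prime p →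
  ∀ ws b₁ {x b₂} → All (λ w → ¬ p ∣ f w) ws → All (λ z → p ∣ g z) b₁ → ¬ p ∣ g x →
  All (λ z → p ∣ g z) b₂ → length ws ≡ length (b₁ ++ x ∷ b₂) →
  ¬ p ∣ weightedSum f g ws (b₁ ++ x ∷ b₂)
weightedSum-pivot-¬∣ pp []       []       _ _ _ _ ()
weightedSum-pivot-¬∣ pp []       (_ ∷ _)  _ _ _ _ ()
weightedSum-pivot-¬∣ {f = f} {g} {p} pp (w ∷ ws) [] {x} {b₂} (¬p∣w ∷ _) [] ¬p∣x p∣b₂ _ p∣sum =
  [ ¬p∣w , ¬p∣x ] (euclidsLemma (f w) (g x) pp p∣wx)
  where
  p∣wx : p ∣ f w * g x
  p∣wx = ∣m+n∣m⇒∣n (subst (p ∣_) (+-comm (f w * g x) (weightedSum f g ws b₂)) p∣sum)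
                   (weightedSum-∣ f g ws p∣b₂)
weightedSum-pivot-¬∣ {f = f} {g} pp (w ∷ ws) (z ∷ b₁) (_ ∷ ¬p∣ws) (p∣z ∷ p∣b₁) ¬p∣x p∣b₂ len p∣sum =
  weightedSum-pivot-¬∣ pp ws b₁ ¬p∣ws p∣b₁ ¬p∣x p∣b₂ (suc-injective len)
    (∣m+n∣m⇒∣n p∣sum (∣n⇒∣m*n (f w) p∣z))

prime⇒>1 : ∀ {p} → Prime p → 1 < p
prime⇒>1 {p} pp = nonTrivial⇒n>1 p {{prime⇒nonTrivial pp}}

coprime-*ʳ : ∀ {a m k} → Coprime a m → Coprime a k → Coprime a (m * k)
coprime-*ʳ {a} {m} {k} a⊥m a⊥k {d} (d∣a , d∣mk) = a⊥k (d∣a , coprime-divisor d⊥m d∣mk)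
  where
  d⊥m : Coprime d m
  d⊥m (e∣d , e∣m) = a⊥m (∣-trans e∣d d∣a , e∣m)

coprime-^ʳ : ∀ {a p} → Coprime a p → ∀ e → Coprime a (p ^ e)
coprime-^ʳ a⊥p zero    (_ , d∣1) = ∣1⇒≡1 d∣1
coprime-^ʳ a⊥p (suc e) = coprime-*ʳ a⊥p (coprime-^ʳ a⊥p e)

coprime-∣ʳ : ∀ {a n d} → Coprime a n → d ∣ n → Coprime a d
coprime-∣ʳ a⊥n d∣n (e∣a , e∣d) = a⊥n (e∣a , ∣-trans e∣d d∣n)

coprime-mod : ∀ {a n} .{{_ : NonZero n}} → Coprime a n → Coprime (toℕ (a mod n)) n
coprime-mod {a} {n} a⊥n (d∣a%n , d∣n) = a⊥n (∣n∣m%n⇒∣m d∣n (subst (_ ∣_) (toℕ-mod a n) d∣a%n) , d∣n)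

coprime-1+*ˡ : ∀ m t → Coprime (1 + m * t) m
coprime-1+*ˡ m t {d} (d∣1+mt , d∣m) = ∣1⇒≡1 (∣m+n∣m⇒∣n (subst (d ∣_) (+-comm 1 (m * t)) d∣1+mt) (∣m⇒∣m*n t d∣m))

¬∣⇒coprime : ∀ {p a} → Prime p → ¬ p ∣ a → Coprime a p
¬∣⇒coprime pp ¬p∣a {d} (d∣a , d∣p) with prime⇒irreducible pp d∣p
... | inj₁ d≡1 = d≡1
... | inj₂ refl = contradiction d∣a ¬p∣a

p-freePart : ∀ {p} → Prime p → ∀ n .{{_ : NonZero n}} → ∃[ e ] ∃[ m ] n ≡ p ^ e * m × ¬ p ∣ m
p-freePart {p} pp = <-rec Split split
  where
  Split : ℕ → Set
  Split n = .{{NonZero n}} → ∃[ e ] ∃[ m ] n ≡ p ^ e * m × ¬ p ∣ m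
  split : ∀ n → (∀ {k} → k < n → Split k) → Split n
  split n rec with p ∣? n
  ... | no ¬p∣n = 0 , n , sym (*-identityˡ n) , ¬p∣n
  ... | yes (divides q refl) with rec (m<m*n q p {{m*n≢0⇒m≢0 q}} (prime⇒>1 pp)) {{m*n≢0⇒m≢0 q}}
  ...   | e , m , refl , ¬p∣m = suc e , m , trans (*-comm (p ^ e * m) p) (sym (*-assoc p (p ^ e) m)) , ¬p∣m

linearCongruence-solvable : ∀ {m d} .{{_ : NonZero d}} → Coprime m d → ∀ c → ∃[ t ] d ∣ m * t + c
linearCongruence-solvable {m} {d} m⊥d c with coprime-Bézout m⊥d
... | Bézout.-+ x y eq = x * c , divides (c * y) (begin
  m * (x * c) + c   ≡⟨ factor m x c ⟩
  c * (1 + x * m)   ≡⟨ cong (c *_) eq ⟩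
  c * (y * d)       ≡⟨ *-assoc c y d ⟨
  c * y * d         ∎)
  where
  open ≡-Reasoning
  factor : ∀ m x c → m * (x * c) + c ≡ c * (1 + x * m)
  factor = solve-∀
linearCongruence-solvable {m} {d@(suc q)} m⊥d c | Bézout.+- x y eq = x * c * q , divides (c * (1 + q * y)) (begin
  m * (x * c * q) + c        ≡⟨ factor m x c q ⟩
  c * (1 + q * (x * m))      ≡⟨ cong (λ z → c * (1 + q * z)) eq ⟨
  c * (1 + q * (1 + y * d))  ≡⟨ refactor c q y ⟩
  c * (1 + q * y) * d        ∎)
  where
  open ≡-Reasoning
  factor : ∀ m x c q → m * (x * c * q) + c ≡ c * (1 + q * (x * m))
  factor = solve-∀
  refactor : ∀ c q y → c * (1 + q * (1 + y * suc q)) ≡ c * (1 + q * y) * suc q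
  refactor = solve-∀

-- With n = pᵉ m and p ∤ m, the solution is sought as a = 1 + m t, which is prime to m.
linearCongruence-unitSolvable : ∀ {p} → Prime p → ∀ n .{{_ : NonZero n}} {x y} → ¬ p ∣ x → ¬ p ∣ y →
  ∃[ a ] Coprime a n × p ∣ a * x + y
linearCongruence-unitSolvable {p} pp n {x} {y} ¬p∣x ¬p∣y
  with p-freePart pp n
... | e , m , refl , ¬p∣m
  with linearCongruence-solvable {{prime⇒nonZero pp}} (¬∣⇒coprime pp ¬p∣mx) (x + y)
  where
  ¬p∣mx : ¬ p ∣ m * x
  ¬p∣mx p∣mx = [ ¬p∣m , ¬p∣x ] (euclidsLemma m x pp p∣mx)
... | t , p∣ = a , coprime-*ʳ (coprime-^ʳ (¬∣⇒coprime pp ¬p∣a) e) (coprime-1+*ˡ m t) , p∣ax+y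
  where
  a = 1 + m * t
  p∣ax+y : p ∣ a * x + y
  p∣ax+y = subst (p ∣_) (rearrange m t x y) p∣
    where
    rearrange : ∀ m t x y → m * x * t + (x + y) ≡ (1 + m * t) * x + y
    rearrange = solve-∀
  ¬p∣a : ¬ p ∣ a
  ¬p∣a p∣a = ¬p∣y (∣m+n∣m⇒∣n p∣ax+y (∣m⇒∣m*n x p∣a))

module _ {m : ℕ} {B : Fin m → Set} where

  hasZSBlock-infix : ∀ {xs} pre ys post → xs ≡ pre ++ ys ++ post → HasZSBlock m B ys → HasZSBlock m B xs
  hasZSBlock-infix pre ys post refl (pre′ , blk , post′ , refl , zs) =
    pre ++ pre′ , blk , post′ ++ post , infix-++-assoc pre pre′ blk post′ post , zs

  allHaveZSBlock-≤ : ∀ {k} → AllHaveZSBlock m B k → ∀ xs → k ≤ length xs → HasZSBlock m B xs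
  allHaveZSBlock-≤ {k} all xs k≤ =
    hasZSBlock-infix [] (take k xs) (drop k xs) (sym (take++drop≡id k xs))
      (all (take k xs) (trans (length-take k xs) (m≤n⇒m⊓n≡m k≤)))

  extremal-criterion : ∀ xs → ¬ HasZSBlock m B xs → AllHaveZSBlock m B (suc (length xs)) → Extremal m B xs
  extremal-criterion xs noBlock all = (suc (length xs) , (s≤s z≤n , all , minimal) , refl) , noBlock
    where
    minimal : ∀ k → 1 ≤ k → AllHaveZSBlock m B k → suc (length xs) ≤ k
    minimal k _ allₖ with k ≤? length xs
    ... | yes k≤ = contradiction (allHaveZSBlock-≤ allₖ xs k≤) noBlock
    ... | no k≰  = ≰⇒> k≰

-- Segmenting a sequence into blocks

module GreedySegmentation {A : Set} {P : A → Set} (P? : Decidable P) (Block : List A → Set)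
  (singleton : ∀ {x} → P x → Block (x ∷ []))
  (pair : ∀ {x zs y} → ¬ P x → All P zs → ¬ P y → Block (x ∷ zs ++ y ∷ []))
  where

  Blocks : Set
  Blocks = List (∃ Block)

  terms : Blocks → List A
  terms = concatMap proj₁

  record Tiling (s : List A) : Set where
    constructor tiling
    field
      blocks : Blocks
      rest   : List A
      tiles  : s ≡ terms blocks ++ rest

  record Segmentation (s : List A) : Set where
    constructor segmentation
    field
      prefix : List A
      blocks : Blocks
      rest   : List A
      splits : s ≡ prefix ++ terms blocks ++ rest

  count : ∀ {s} → Segmentation s → ℕ
  count σ = length (Segmentation.blocks σ)

  private
    open Tiling

    _◅_ : ∀ {b s} → Block b → Tiling s → Tiling (b ++ s)
    _◅_ {b} β τ = tiling ((b , β) ∷ blocks τ) (rest τ)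
      (trans (cong (b ++_) (tiles τ)) (sym (++-assoc b (terms (blocks τ)) (rest τ))))

    retile : ∀ {s s′} → s ≡ s′ → Tiling s → Tiling s′
    retile eq τ = tiling (blocks τ) (rest τ) (trans (sym eq) (tiles τ))

    greedy : ∀ s → Tiling s
    closing : ∀ {x} zs → ¬ P x → All P zs → ∀ t → Tiling (x ∷ zs ++ t)

    greedy []      = tiling [] [] refl
    greedy (x ∷ s) with P? x
    ... | yes px = singleton px ◅ greedy s
    ... | no ¬px = closing [] ¬px [] s

    closing {x} zs ¬px pzs []      = tiling [] (x ∷ zs ++ []) refl
    closing {x} zs ¬px pzs (z ∷ t) with P? z
    ... | yes pz = retile (cong (x ∷_) (++-assoc zs (z ∷ []) t))
                          (closing (zs ++ z ∷ []) ¬px (All.++⁺ pzs (pz ∷ [])) t)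
    ... | no ¬pz = retile (cong (x ∷_) (++-assoc zs (z ∷ []) t)) (pair ¬px pzs ¬pz ◅ greedy t)

    fromStart : ∀ s → Segmentation s
    fromStart s = segmentation [] (blocks (greedy s)) (rest (greedy s)) (tiles (greedy s))

    afterFirstGap : ∀ s → Segmentation s
    afterFirstGap []      = segmentation [] [] [] refl
    afterFirstGap (x ∷ s) with P? x
    ... | yes _ = let segmentation pre bs r eq = afterFirstGap s in
                  segmentation (x ∷ pre) bs r (cong (x ∷_) eq)
    ... | no _  = segmentation (x ∷ []) (blocks (greedy s)) (rest (greedy s)) (cong (x ∷_) (tiles (greedy s)))

    length≤closing+greedy : ∀ {x} zs (¬px : ¬ P x) pzs t →
      length t ≤ length (blocks (closing zs ¬px pzs t)) + length (blocks (greedy t))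
    length≤closing+greedy zs ¬px pzs []      = z≤n
    length≤closing+greedy zs ¬px pzs (z ∷ t) with P? z
    ... | yes pz = ≤-trans (s≤s (length≤closing+greedy (zs ++ z ∷ []) ¬px (All.++⁺ pzs (pz ∷ [])) t))
                           (≤-reflexive (sym (+-suc _ _)))
    ... | no ¬pz = s≤s (≤-trans (length≤closing+greedy [] ¬pz [] t)
                                (≤-reflexive (+-comm (length (blocks (closing [] ¬pz [] t))) _)))

    length≤fromStart+afterFirstGap : ∀ s → length s ≤ suc (count (fromStart s) + count (afterFirstGap s))
    length≤fromStart+afterFirstGap []      = z≤n
    length≤fromStart+afterFirstGap (x ∷ s) with P? x
    ... | yes _  = s≤s (length≤fromStart+afterFirstGap s)
    ... | no ¬px = s≤s (length≤closing+greedy [] ¬px [] s)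

  -- The two tilings pair off the terms outside P with opposite parities, so each term in P is a
  -- singleton block of at least one of them, and together they have at least (#terms outside P) − 1
  -- pair blocks: their block counts add up to at least length s − 1.
  longSegmentation : ∀ s → Σ (Segmentation s) λ σ → length s ≤ suc (count σ + count σ)
  longSegmentation s with ≤-total (count (fromStart s)) (count (afterFirstGap s))
  ... | inj₁ f≤a = afterFirstGap s , ≤-trans (length≤fromStart+afterFirstGap s) (s≤s (+-monoˡ-≤ _ f≤a))
  ... | inj₂ a≤f = fromStart s , ≤-trans (length≤fromStart+afterFirstGap s) (s≤s (+-monoʳ-≤ _ a≤f))

m+m≤1+n+n⇒m≤n : ∀ {m n} → m + m ≤ suc (n + n) → m ≤ n
m+m≤1+n+n⇒m≤n {zero}  _ = z≤n
m+m≤1+n+n⇒m≤n {suc m} {zero} (s≤s le) rewrite +-suc m m = contradiction le λ ()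
m+m≤1+n+n⇒m≤n {suc m} {suc n} (s≤s le) rewrite +-suc m m | +-suc n n = s≤s (m+m≤1+n+n⇒m≤n (s≤s⁻¹ le))

module Extension (n′ p : ℕ) (pp : Prime p) .{{_ : NonZero n′}} where

  n : ℕ
  n = n′ * p

  instance
    nonZero-p : NonZero p
    nonZero-p = prime⇒nonZero pp
    nonZero-n : NonZero n
    nonZero-n = m*n≢0 n′ p

  p∣n : p ∣ n
  p∣n = n∣m*n n′

  unit⇒¬p∣ : ∀ {a} → U n a → ¬ p ∣ toℕ a
  unit⇒¬p∣ a⊥n p∣a = <⇒≢ (prime⇒>1 pp) (sym (a⊥n (p∣a , p∣n)))

  scaled : Fin n′ → Fin n
  scaled = scale p refl

  toℕ-scaled : ∀ u → toℕ (scaled u) ≡ toℕ u * p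
  toℕ-scaled u = toℕ-fromℕ< _

  scaled-divisible : ∀ us → All (λ z → p ∣ toℕ z) (map scaled us)
  scaled-divisible []       = []
  scaled-divisible (u ∷ us) = subst (p ∣_) (sym (toℕ-scaled u)) (n∣m*n (toℕ u)) ∷ scaled-divisible us

  reduce : Fin n → Fin n′
  reduce b = toℕ b mod n′

  unit-reduce : ∀ {b} → U n b → U n′ (reduce b)
  unit-reduce b⊥n = coprime-mod (coprime-∣ʳ b⊥n (m∣m*n p))

  zeroSum-unscale : ∀ us → WeightedZeroSum n (U n) (map scaled us) → WeightedZeroSum n′ (U n′) us
  zeroSum-unscale us (nonempty , bs , aligned , units , n∣sum) =
    subst (1 ≤_) (length-map scaled us) nonempty ,
    map reduce bs ,
    trans (length-map reduce bs) (trans aligned (length-map scaled us)) ,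
    All.map⁺ (All.map unit-reduce units) ,
    n′∣reduced
    where
    unscale : weightedSum toℕ toℕ bs (map scaled us) ≡ weightedSum toℕ toℕ bs us * p
    unscale = begin
      weightedSum toℕ toℕ bs (map scaled us)           ≡⟨ weightedSum-mapʳ toℕ toℕ scaled bs us ⟩
      weightedSum toℕ (toℕ ∘ scaled) bs us             ≡⟨ weightedSum-cong {f = toℕ} (λ _ → refl) toℕ-scaled bs us ⟩
      weightedSum toℕ (λ u → toℕ u * p) bs us          ≡⟨ weightedSum-*ʳ toℕ toℕ p bs us ⟩
      weightedSum toℕ toℕ bs us * p                    ∎
      where open ≡-Reasoning
    reduced≈ : weightedSum toℕ toℕ bs us % n′ ≡ weightedSum toℕ toℕ (map reduce bs) us % n′
    reduced≈ = begin
      weightedSum toℕ toℕ bs us % n′             ≡⟨ weightedSum-cong-% n′ reduce≈ (λ _ → refl) bs us ⟩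
      weightedSum (toℕ ∘ reduce) toℕ bs us % n′  ≡⟨ cong (_% n′) (weightedSum-mapˡ toℕ toℕ reduce bs us) ⟨
      weightedSum toℕ toℕ (map reduce bs) us % n′ ∎
      where
      open ≡-Reasoning
      reduce≈ : ∀ b → toℕ b % n′ ≡ toℕ (reduce b) % n′
      reduce≈ b = sym (toℕ-mod-% (toℕ b) n′)
    n′∣reduced : n′ ∣ weightedSum toℕ toℕ (map reduce bs) us
    n′∣reduced = ∣-resp-% n′ reduced≈ (*-cancelʳ-∣ p (subst (n ∣_) unscale n∣sum))

  unscaledBlock : ∀ S pre blk post → map scaled S ≡ pre ++ blk ++ post →
    WeightedZeroSum n (U n) blk → HasZSBlock n′ (U n′) S
  unscaledBlock S pre blk post eq zs with map-≡-infix scaled S pre blk post eq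
  ... | pre′ , blk′ , post′ , S≡ , refl = pre′ , blk′ , post′ , S≡ , zeroSum-unscale blk′ zs

  noZSBlock : ∀ S₁ S₂ x → ¬ p ∣ toℕ x → ¬ HasZSBlock n′ (U n′) S₁ → ¬ HasZSBlock n′ (U n′) S₂ →
    ¬ HasZSBlock n (U n) (map scaled S₁ ++ x ∷ map scaled S₂)
  noZSBlock S₁ S₂ x ¬p∣x ¬zs₁ ¬zs₂ (pre , blk , post , eq , zs)
    with infixAround (map scaled S₁) x (map scaled S₂) pre blk post eq
  ... | inLeft  pre′ post′ eq′ = ¬zs₁ (unscaledBlock S₁ pre′ blk post′ eq′ zs)
  ... | inRight pre′ post′ eq′ = ¬zs₂ (unscaledBlock S₂ pre′ blk post′ eq′ zs)
  ... | through pre′ blk₁ blk₂ post′ eq₁ eq₂ refl =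
    let (_ , ws , aligned , units , n∣sum) = zs in
    weightedSum-pivot-¬∣ pp ws blk₁ (All.map unit⇒¬p∣ units)
      (All.++⁻ʳ pre′ (subst (All _) eq₁ (scaled-divisible S₁))) ¬p∣x
      (All.++⁻ˡ blk₂ (subst (All _) eq₂ (scaled-divisible S₂))) aligned (∣-trans p∣n n∣sum)

  record DivisibleBlock (blk : List (Fin n)) : Set where
    field
      weights   : List (Fin n)
      aligned   : length weights ≡ length blk
      units     : All (U n) weights
      nonempty  : 1 ≤ length blk
      divisible : p ∣ weightedSum toℕ toℕ weights blk

  one : Fin n
  one = fromℕ< (<-≤-trans (prime⇒>1 pp) (m≤n*m p n′))

  toℕ-one : toℕ one ≡ 1
  toℕ-one = toℕ-fromℕ< _

  unit-one : U n one
  unit-one = subst (λ a → Coprime a n) (sym toℕ-one) (1-coprimeTo n)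

  singletonBlock : ∀ {x} → p ∣ toℕ x → DivisibleBlock (x ∷ [])
  singletonBlock p∣x = record
    { weights = one ∷ [] ; aligned = refl ; units = unit-one ∷ [] ; nonempty = s≤s z≤n
    ; divisible = weightedSum-∣ toℕ toℕ (one ∷ []) (p∣x ∷ []) }

  pairBlock : ∀ {x zs y} → ¬ p ∣ toℕ x → All (λ z → p ∣ toℕ z) zs → ¬ p ∣ toℕ y →
    DivisibleBlock (x ∷ zs ++ y ∷ [])
  pairBlock {x} {zs} {y} ¬p∣x p∣zs ¬p∣y = record
    { weights   = a mod n ∷ ones ++ one ∷ []
    ; aligned   = cong suc (trans (length-++ ones) (trans (cong (_+ 1) (length-replicate (length zs))) (sym (length-++ zs))))
    ; units     = coprime-mod a⊥n
                  ∷ All.++⁺ (All.replicate⁺ (length zs) unit-one) (unit-one ∷ [])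
    ; nonempty  = s≤s z≤n
    ; divisible = subst (p ∣_) (sym sum≡) (∣m∣n⇒∣m+n p∣ax+y (weightedSum-∣ toℕ toℕ ones p∣zs))
    }
    where
    ones = replicate (length zs) one
    solved = linearCongruence-unitSolvable pp n ¬p∣x ¬p∣y
    a = proj₁ solved
    a⊥n = proj₁ (proj₂ solved)
    p∣ax+y : p ∣ toℕ (a mod n) * toℕ x + toℕ y
    p∣ax+y = ∣-resp-% p reduce≈ (proj₂ (proj₂ solved))
      where
      reduce≈ : (a * toℕ x + toℕ y) % p ≡ (toℕ (a mod n) * toℕ x + toℕ y) % p
      reduce≈ = +-cong-% p (*-cong-% p (trans (sym (m∣n⇒o%n%m≡o%m p n a p∣n)) (cong (_% p) (sym (toℕ-mod a n)))) refl) refl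
    sum≡ : weightedSum toℕ toℕ (a mod n ∷ ones ++ one ∷ []) (x ∷ zs ++ y ∷ [])
         ≡ (toℕ (a mod n) * toℕ x + toℕ y) + weightedSum toℕ toℕ ones zs
    sum≡ = begin
      ax + weightedSum toℕ toℕ (ones ++ one ∷ []) (zs ++ y ∷ [])
        ≡⟨ cong (ax +_) (weightedSum-++ toℕ toℕ ones zs (length-replicate (length zs))) ⟩
      ax + (W + (toℕ one * toℕ y + 0))
        ≡⟨ cong (λ o → ax + (W + (o * toℕ y + 0))) toℕ-one ⟩
      ax + (W + (1 * toℕ y + 0))
        ≡⟨ cong (λ t → ax + (W + t)) (trans (+-identityʳ (1 * toℕ y)) (*-identityˡ (toℕ y))) ⟩
      ax + (W + toℕ y)
        ≡⟨ cong (ax +_) (+-comm W (toℕ y)) ⟩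
      ax + (toℕ y + W)
        ≡⟨ +-assoc ax (toℕ y) W ⟨
      ax + toℕ y + W ∎
      where
      open ≡-Reasoning
      ax = toℕ (a mod n) * toℕ x
      W = weightedSum toℕ toℕ ones zs

  -- A lift of w ∈ U(n′) to a unit of ℤ_n: if p ∣ w then p ∤ n′, so w + n′ is prime to p.
  lift : Fin n′ → ℕ
  lift w with p ∣? toℕ w
  ... | yes _ = toℕ w + n′
  ... | no _  = toℕ w

  lift-% : ∀ w → lift w % n′ ≡ toℕ w % n′
  lift-% w with p ∣? toℕ w
  ... | yes _ = [m+n]%n≡m%n (toℕ w) n′
  ... | no _  = refl

  unit-lift : ∀ {w} → U n′ w → Coprime (lift w) n
  unit-lift {w} w⊥n′ with p ∣? toℕ w
  ... | yes p∣w = coprime-*ʳ (subst (λ l → Coprime l n′) (+-comm n′ (toℕ w)) (Coprime.coprime-+ w⊥n′))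
                             (¬∣⇒coprime pp ¬p∣w+n′)
    where
    ¬p∣w+n′ : ¬ p ∣ toℕ w + n′
    ¬p∣w+n′ p∣w+n′ = <⇒≢ (prime⇒>1 pp) (sym (w⊥n′ (p∣w , ∣m+n∣m⇒∣n p∣w+n′ p∣w)))
  ... | no ¬p∣w = coprime-*ʳ w⊥n′ (¬∣⇒coprime pp ¬p∣w)

  open GreedySegmentation (λ z → p ∣? toℕ z) DivisibleBlock singletonBlock pairBlock

  quotientOf : ∃ DivisibleBlock → ℕ
  quotientOf (_ , β) = quotient (DivisibleBlock.divisible β)

  residue : ∃ DivisibleBlock → Fin n′
  residue β = quotientOf β mod n′

  rescale : ℕ → Fin n → Fin n
  rescale L a = (L * toℕ a) mod n

  combinedWeights : List (Fin n′) → Blocks → List (Fin n)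
  combinedWeights []       _              = []
  combinedWeights (_ ∷ _)  []             = []
  combinedWeights (w ∷ ws) ((_ , β) ∷ βs) =
    map (rescale (lift w)) (DivisibleBlock.weights β) ++ combinedWeights ws βs

  combinedWeights-aligned : ∀ ws βs → length ws ≡ length βs → length (combinedWeights ws βs) ≡ length (terms βs)
  combinedWeights-aligned []       []             _   = refl
  combinedWeights-aligned (w ∷ ws) ((blk , β) ∷ βs) len = begin
    length (map _ weights ++ combinedWeights ws βs)        ≡⟨ length-++ (map _ weights) ⟩
    length (map _ weights) + length (combinedWeights ws βs) ≡⟨ cong₂ _+_ (trans (length-map _ weights) aligned)
                                                                     (combinedWeights-aligned ws βs (suc-injective len)) ⟩
    length blk + length (terms βs)                          ≡⟨ length-++ blk ⟨
    length (blk ++ terms βs)                                ∎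
    where
    open ≡-Reasoning
    open DivisibleBlock β

  unit-rescale : ∀ {L a} → Coprime L n → U n a → U n (rescale L a)
  unit-rescale L⊥n a⊥n = coprime-mod (Coprime.sym (coprime-*ʳ (Coprime.sym L⊥n) (Coprime.sym a⊥n)))

  rescaled-sum : ∀ L (as xs : List (Fin n)) →
    weightedSum toℕ toℕ (map (rescale L) as) xs % n ≡ (L * weightedSum toℕ toℕ as xs) % n
  rescaled-sum L as xs = begin
    weightedSum toℕ toℕ (map (rescale L) as) xs % n
      ≡⟨ cong (_% n) (weightedSum-mapˡ toℕ toℕ (rescale L) as xs) ⟩
    weightedSum (toℕ ∘ rescale L) toℕ as xs % n
      ≡⟨ weightedSum-cong-% n (λ a → toℕ-mod-% (L * toℕ a) n) (λ _ → refl) as xs ⟩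
    weightedSum (λ a → L * toℕ a) toℕ as xs % n
      ≡⟨ cong (_% n) (weightedSum-*ˡ toℕ toℕ L as xs) ⟩
    (L * weightedSum toℕ toℕ as xs) % n ∎
    where open ≡-Reasoning

  combinedWeights-units : ∀ {ws} → All (U n′) ws → ∀ βs → All (U n) (combinedWeights ws βs)
  combinedWeights-units []         _              = []
  combinedWeights-units (_ ∷ _)    []             = []
  combinedWeights-units (w⊥ ∷ ws⊥) ((_ , β) ∷ βs) =
    All.++⁺ (All.map⁺ (All.map (unit-rescale (unit-lift w⊥)) (DivisibleBlock.units β)))
            (combinedWeights-units ws⊥ βs)

  combinedWeights-sum : ∀ ws βs → length ws ≡ length βs →
    weightedSum toℕ toℕ (combinedWeights ws βs) (terms βs) % n ≡ (weightedSum lift quotientOf ws βs * p) % n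
  combinedWeights-sum []       []               _   = refl
  combinedWeights-sum (w ∷ ws) ((blk , β) ∷ βs) len = begin
    weightedSum toℕ toℕ (map (rescale (lift w)) weights ++ combinedWeights ws βs) (blk ++ terms βs) % n
      ≡⟨ cong (_% n) (weightedSum-++ toℕ toℕ (map (rescale (lift w)) weights) blk
                                      (trans (length-map (rescale (lift w)) weights) aligned)) ⟩
    (weightedSum toℕ toℕ (map (rescale (lift w)) weights) blk + weightedSum toℕ toℕ (combinedWeights ws βs) (terms βs)) % n
      ≡⟨ +-cong-% n (rescaled-sum (lift w) weights blk) (combinedWeights-sum ws βs (suc-injective len)) ⟩
    (lift w * weightedSum toℕ toℕ weights blk + rest * p) % n
      ≡⟨ cong (λ t → (lift w * t + rest * p) % n) (m∣n⇒n≡quotient*m divisible) ⟩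
    (lift w * (q * p) + rest * p) % n
      ≡⟨ cong (_% n) (trans (cong (_+ rest * p) (sym (*-assoc (lift w) q p))) (sym (*-distribʳ-+ p (lift w * q) rest))) ⟩
    ((lift w * q + rest) * p) % n ∎
    where
    open ≡-Reasoning
    open DivisibleBlock β
    q = quotient divisible
    rest = weightedSum lift quotientOf ws βs

  zeroSum-combine : ∀ ws βs → All (U n′) ws → length ws ≡ length βs → 1 ≤ length βs →
    n′ ∣ weightedSum toℕ toℕ ws (map residue βs) → WeightedZeroSum n (U n) (terms βs)
  zeroSum-combine ws βs@((blk , β) ∷ _) units aligned _ n′∣residues =
    ≤-trans (DivisibleBlock.nonempty β) (length-++-≤ˡ blk) ,
    combinedWeights ws βs ,
    combinedWeights-aligned ws βs aligned ,
    combinedWeights-units units βs ,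
    ∣-resp-% n (sym (combinedWeights-sum ws βs aligned)) (*-monoˡ-∣ p n′∣quotients)
    where
    residues≈ : weightedSum toℕ toℕ ws (map residue βs) % n′ ≡ weightedSum lift quotientOf ws βs % n′
    residues≈ = trans (cong (_% n′) (weightedSum-mapʳ toℕ toℕ residue ws βs))
      (weightedSum-cong-% n′ (λ w → sym (lift-% w))
                          (λ β → toℕ-mod-% (quotientOf β) n′) ws βs)
    n′∣quotients : n′ ∣ weightedSum lift quotientOf ws βs
    n′∣quotients = ∣-resp-% n′ residues≈ n′∣residues

  upperBound : ∀ c → AllHaveZSBlock n′ (U n′) c → AllHaveZSBlock n (U n) (c + c)
  upperBound c allₙ′ s len
    with longSegmentation s
  ... | segmentation pre βs rest s≡ , long
    with allHaveZSBlock-≤ allₙ′ (map residue βs)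
           (subst (c ≤_) (sym (length-map residue βs)) (m+m≤1+n+n⇒m≤n (subst (_≤ _) len long)))
  ... | pre′ , blk , post′ , residues≡ , (nonempty , ws , aligned , units , n′∣)
    with map-≡-infix residue βs pre′ blk post′ residues≡
  ... | βs₁ , βs₂ , βs₃ , refl , refl =
    hasZSBlock-infix pre (terms (βs₁ ++ βs₂ ++ βs₃)) rest s≡
      (terms βs₁ , terms βs₂ , terms βs₃ ,
       trans (concatMap-++ proj₁ βs₁ _) (cong (terms βs₁ ++_) (concatMap-++ proj₁ βs₂ βs₃)) ,
       zeroSum-combine ws βs₂ units (trans aligned (length-map residue βs₂))
                       (subst (1 ≤_) (length-map residue βs₂) nonempty) n′∣)

-- Oddness of n serves only to exclude n′ = 0; the argument works for every n ≥ 1.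
mainTheorem1 : (n p n' : ℕ) → ¬ (2 ∣ n) → (pp : Prime p) → (eq : n ≡ n' * p) →
    (S₁ S₂ : List (Fin n')) → length S₁ ≡ length S₂ →
    Extremal n' (U n') S₁ → Extremal n' (U n') S₂ →
    (xstar : Fin n) → ¬ (p ∣ toℕ xstar) →
    Extremal n (U n)
      (map (scale p {{prime⇒nonZero pp}} eq) S₁ ++
        (xstar ∷ map (scale p {{prime⇒nonZero pp}} eq) S₂))
mainTheorem1 _ p zero        odd pp refl _  _  _   _ _ _ _ = contradiction (2 ∣0) odd
mainTheorem1 _ p n′@(suc _) odd pp refl S₁ S₂ len ((c , (_ , allₙ′ , _) , c≡) , ¬zs₁) (_ , ¬zs₂) x ¬p∣x =
  extremal-criterion S (noZSBlock S₁ S₂ x ¬p∣x ¬zs₁ ¬zs₂)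
    (subst (AllHaveZSBlock n (U n)) (sym lengthS) (upperBound c allₙ′))
  where
  open Extension n′ p pp
  S = map scaled S₁ ++ x ∷ map scaled S₂
  lengthS : suc (length S) ≡ c + c
  lengthS = trans (cong suc (length-map-++-∷ scaled S₁ x S₂)) (cong₂ _+_ c≡ (trans (cong suc (sym len)) c≡))
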